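{- Let $q$ be a prime power and $n,d$ positive integers with $d<\frac{n+1}{2}$. Then the sequence $(m_0,m_1,\dots,m_d)$ of multiplicities of the Grassmann scheme $Gr(n,d)$ over $\mathbb{F}_q$, given by $m_i={n\brack i}_q-{n\brack i-1}_q$ (with ${n\brack -1}_q=0$), is log-concave.
   Context: ${n\brack i}_q$ denotes the Gaussian binomial coefficient (number of $i$-dimensional subspaces of $\mathbb{F}_q^n$). The Grassmann scheme $Gr(n,d)$ is the association scheme on the $d$-dimensional subspaces of $\mathbb{F}_q^n$, two subspaces being in relation $R_i$ iff their intersection has dimension $d-i$; in its standard ordering of eigenspaces the multiplicities are $m_i={n\brack i}_q-{n\brack i-1}_q$, $0\le i\le d$. A sequence $(s_0,\dots,s_d)$ is log-concave if $s_i^2\ge s_{i-1}s_{i+1}$ for all $1\le i\le d-1$. -}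

module Defs where

open import Data.Nat using (ℕ; zero; suc; _+_; _*_; _^_)
open import Data.Integer as ℤ using (ℤ; +_)

gauss : ℕ → ℕ → ℕ → ℕ
gauss q zero    zero    = 1
gauss q zero    (suc k) = 0
gauss q (suc n) zero    = 1
gauss q (suc n) (suc k) = gauss q n k + q ^ suc k * gauss q n (suc k)

gaussPred : ℕ → ℕ → ℕ → ℕ
gaussPred q n zero    = 0
gaussPred q n (suc i) = gauss q n i

mult : ℕ → ℕ → ℕ → ℤ
mult q n i = + gauss q n i ℤ.- + gaussPred q n i

{-# OPTIONS --safe #-}
-- Write g i = [n i]_q.  The q-Pascal rule gives g (i+1) (q^(i+1) - 1) = g i (q^(n-i) - 1), hence
-- m i (q^(n+1-i) - 1) = g i (q^(n+1-i) - q^i): m i = g i F i / D i with F i = q^(n+1-i) - q^i and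
-- D i = q^(n+1-i) - 1.  After clearing the positive denominators, m i ^ 2 ≥ m (i-1) m (i+1) is the
-- product of D i A i ≤ D (i-1) A (i+1), where A i = q^i - 1 (monotonicity of powers of q), and of
-- the log-concavity F (i-1) F (i+1) ≤ F i ^ 2, whose defect is q^(n-1) (q^2 - 1)^2.  This works for
-- every 1 ≤ i < n, so of the hypotheses only q ≥ 2 and i + 1 ≤ n are needed.
module Submission where

open import Defs
open import Data.Nat as ℕ using (ℕ; zero; suc; _∸_; z≤n; s≤s)
import Data.Nat.Properties as ℕ
open import Data.Nat.Primality using (Prime; prime⇒nonZero; prime⇒nonTrivial)
open import Data.Integer as ℤ using (ℤ)
open import Data.Product using (∃₂; _×_; _,_)
open import Relation.Binary.PropositionalEquality
open import Relation.Nullary using (yes; no)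

module _ where
  open import Data.Integer
    using (+_; +0; +[1+_]; -[1+_]; 0ℤ; 1ℤ; -1ℤ; _+_; _-_; _*_; _^_; _≤_; _<_; +≤+; +<+; nonNegative; positive)
  open import Data.Integer.Properties
  open import Data.Integer.Tactic.RingSolver using (solve-∀)

  0≤i*j : ∀ {i j} → 0ℤ ≤ i → 0ℤ ≤ j → 0ℤ ≤ i * j
  0≤i*j {j = j} 0≤i 0≤j = *-monoʳ-≤-nonNeg j {{nonNegative 0≤j}} 0≤i

  0<i*j : ∀ {i j} → 0ℤ < i → 0ℤ < j → 0ℤ < i * j
  0<i*j {j = j} 0<i 0<j = *-monoʳ-<-pos j {{positive 0<j}} 0<i

  0≤i*i : ∀ i → 0ℤ ≤ i * i
  0≤i*i +0       = +≤+ z≤n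
  0≤i*i +[1+ n ] = +≤+ z≤n
  0≤i*i -[1+ n ] = +≤+ z≤n

  *-mono-≤-nonNeg : ∀ {i j k l} → 0ℤ ≤ i → 0ℤ ≤ l → i ≤ j → k ≤ l → i * k ≤ j * l
  *-mono-≤-nonNeg {i} {j} {k} {l} 0≤i 0≤l i≤j k≤l = ≤-trans
    (*-monoˡ-≤-nonNeg i {{nonNegative 0≤i}} k≤l)
    (*-monoʳ-≤-nonNeg l {{nonNegative 0≤l}} i≤j)

  1≤i^n : ∀ {i} → 1ℤ ≤ i → ∀ n → 1ℤ ≤ i ^ n
  1≤i^n 1≤i zero    = ≤-refl
  1≤i^n 1≤i (suc n) = *-mono-≤-nonNeg (+≤+ z≤n) (≤-trans (+≤+ z≤n) (1≤i^n 1≤i n)) 1≤i (1≤i^n 1≤i n)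

  ^-monoʳ-≤ : ∀ {i} → 1ℤ ≤ i → ∀ {m n} → m ℕ.≤ n → i ^ m ≤ i ^ n
  ^-monoʳ-≤ 1≤i {n = n} z≤n = 1≤i^n 1≤i n
  ^-monoʳ-≤ {i} 1≤i {suc m} {suc n} (s≤s m≤n) =
    *-monoˡ-≤-nonNeg i {{nonNegative (≤-trans (+≤+ z≤n) 1≤i)}} (^-monoʳ-≤ 1≤i m≤n)

  0<i^n-1 : ∀ {i} → 1ℤ < i → ∀ n → 0 ℕ.< n → 0ℤ < i ^ n - 1ℤ
  0<i^n-1 {i} 1<i (suc n) _ = +-monoˡ-< -1ℤ (<-≤-trans 1<i i≤i^[1+n])
    where
    i≤i^[1+n] : i ≤ i ^ suc n
    i≤i^[1+n] = subst (_≤ i ^ suc n) (^-identityʳ i) (^-monoʳ-≤ (<⇒≤ 1<i) {1} {suc n} (s≤s z≤n))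

  [x²y-z][y-x²z]≤[xy-xz]² : ∀ x y z → 0ℤ ≤ y * z →
    (x * (x * y) - z) * (y - x * (x * z)) ≤ (x * y - x * z) * (x * y - x * z)
  [x²y-z][y-x²z]≤[xy-xz]² x y z 0≤yz = begin
    (x * (x * y) - z) * (y - x * (x * z))
      ≤⟨ i≤i+j _ (y * z * ((x * x - 1ℤ) * (x * x - 1ℤ))) {{nonNegative (0≤i*j 0≤yz (0≤i*i (x * x - 1ℤ)))}} ⟩
    (x * (x * y) - z) * (y - x * (x * z)) + y * z * ((x * x - 1ℤ) * (x * x - 1ℤ))
      ≡⟨ identity x y z ⟩
    (x * y - x * z) * (x * y - x * z) ∎
    where
    open ≤-Reasoning
    identity : ∀ x y z → (x * (x * y) - z) * (y - x * (x * z)) + y * z * ((x * x - 1ℤ) * (x * x - 1ℤ))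
                       ≡ (x * y - x * z) * (x * y - x * z)
    identity = solve-∀

  -- m₁ ^ 2 / (m₀ m₂) = (D₀ A₂ / D₁ A₁) (F₁ ^ 2 / F₀ F₂), and M clears all the denominators.
  module LogConcavityTransfer
    (g m D A F : ℕ → ℤ)
    (ratio : ∀ i → g (suc i) * A (suc i) ≡ g i * D (suc i))
    (scaled : ∀ i → m i * D i ≡ g i * F i)
    (j : ℕ)
    where

    g₀ g₁ g₂ m₀ m₁ m₂ D₀ D₁ D₂ A₁ A₂ F₀ F₁ F₂ M c : ℤ
    g₀ = g j
    g₁ = g (suc j)
    g₂ = g (suc (suc j))
    m₀ = m j
    m₁ = m (suc j)
    m₂ = m (suc (suc j))
    D₀ = D j
    D₁ = D (suc j)
    D₂ = D (suc (suc j))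
    A₁ = A (suc j)
    A₂ = A (suc (suc j))
    F₀ = F j
    F₁ = F (suc j)
    F₂ = F (suc (suc j))
    M = D₀ * D₁ * D₁ * D₂ * A₁ * A₂
    c = g₁ * g₁ * (A₁ * D₂)

    M*m₁*m₁ : M * (m₁ * m₁) ≡ c * (D₀ * A₂ * (F₁ * F₁))
    M*m₁*m₁ = begin
      M * (m₁ * m₁)                              ≡⟨ regroup₁ D₀ D₁ D₂ A₁ A₂ m₁ ⟩
      D₀ * D₂ * A₁ * A₂ * (m₁ * D₁ * (m₁ * D₁))  ≡⟨ cong (λ t → D₀ * D₂ * A₁ * A₂ * (t * t)) (scaled (suc j)) ⟩
      D₀ * D₂ * A₁ * A₂ * (g₁ * F₁ * (g₁ * F₁))  ≡⟨ regroup₂ D₀ D₂ A₁ A₂ g₁ F₁ ⟩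
      c * (D₀ * A₂ * (F₁ * F₁))                  ∎
      where
      open ≡-Reasoning
      regroup₁ : ∀ D₀ D₁ D₂ A₁ A₂ m₁ →
        D₀ * D₁ * D₁ * D₂ * A₁ * A₂ * (m₁ * m₁) ≡ D₀ * D₂ * A₁ * A₂ * (m₁ * D₁ * (m₁ * D₁))
      regroup₁ = solve-∀
      regroup₂ : ∀ D₀ D₂ A₁ A₂ g₁ F₁ →
        D₀ * D₂ * A₁ * A₂ * (g₁ * F₁ * (g₁ * F₁)) ≡ g₁ * g₁ * (A₁ * D₂) * (D₀ * A₂ * (F₁ * F₁))
      regroup₂ = solve-∀

    M*m₀*m₂ : M * (m₀ * m₂) ≡ c * (D₁ * A₁ * (F₀ * F₂))
    M*m₀*m₂ = begin
      M * (m₀ * m₂)                              ≡⟨ regroup₁ D₀ D₁ D₂ A₁ A₂ m₀ m₂ ⟩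
      D₁ * D₁ * A₁ * A₂ * (m₀ * D₀ * (m₂ * D₂))  ≡⟨ cong₂ (λ s t → D₁ * D₁ * A₁ * A₂ * (s * t)) (scaled j) (scaled (suc (suc j))) ⟩
      D₁ * D₁ * A₁ * A₂ * (g₀ * F₀ * (g₂ * F₂))  ≡⟨ regroup₂ D₁ A₁ A₂ g₀ g₂ F₀ F₂ ⟩
      D₁ * A₁ * F₀ * F₂ * (g₀ * D₁ * (g₂ * A₂))  ≡⟨ cong₂ (λ s t → D₁ * A₁ * F₀ * F₂ * (s * t)) (sym (ratio j)) (ratio (suc j)) ⟩
      D₁ * A₁ * F₀ * F₂ * (g₁ * A₁ * (g₁ * D₂))  ≡⟨ regroup₃ D₁ D₂ A₁ F₀ F₂ g₁ ⟩
      c * (D₁ * A₁ * (F₀ * F₂))                  ∎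
      where
      open ≡-Reasoning
      regroup₁ : ∀ D₀ D₁ D₂ A₁ A₂ m₀ m₂ →
        D₀ * D₁ * D₁ * D₂ * A₁ * A₂ * (m₀ * m₂) ≡ D₁ * D₁ * A₁ * A₂ * (m₀ * D₀ * (m₂ * D₂))
      regroup₁ = solve-∀
      regroup₂ : ∀ D₁ A₁ A₂ g₀ g₂ F₀ F₂ →
        D₁ * D₁ * A₁ * A₂ * (g₀ * F₀ * (g₂ * F₂)) ≡ D₁ * A₁ * F₀ * F₂ * (g₀ * D₁ * (g₂ * A₂))
      regroup₂ = solve-∀
      regroup₃ : ∀ D₁ D₂ A₁ F₀ F₂ g₁ →
        D₁ * A₁ * F₀ * F₂ * (g₁ * A₁ * (g₁ * D₂)) ≡ g₁ * g₁ * (A₁ * D₂) * (D₁ * A₁ * (F₀ * F₂))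
      regroup₃ = solve-∀

    log-concave : 0ℤ < D₀ → 0ℤ < D₁ → 0ℤ < D₂ → 0ℤ < A₁ → 0ℤ < A₂ →
                  D₁ * A₁ ≤ D₀ * A₂ → F₀ * F₂ ≤ F₁ * F₁ → m₀ * m₂ ≤ m₁ * m₁
    log-concave 0<D₀ 0<D₁ 0<D₂ 0<A₁ 0<A₂ DA-mono F-log-concave =
      *-cancelˡ-≤-pos (m₀ * m₂) (m₁ * m₁) M {{positive 0<M}} (begin
        M * (m₀ * m₂)              ≡⟨ M*m₀*m₂ ⟩
        c * (D₁ * A₁ * (F₀ * F₂))  ≤⟨ *-monoˡ-≤-nonNeg c {{nonNegative 0≤c}} key ⟩
        c * (D₀ * A₂ * (F₁ * F₁))  ≡⟨ M*m₁*m₁ ⟨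
        M * (m₁ * m₁)              ∎)
      where
      open ≤-Reasoning
      0<M : 0ℤ < M
      0<M = 0<i*j (0<i*j (0<i*j (0<i*j (0<i*j 0<D₀ 0<D₁) 0<D₁) 0<D₂) 0<A₁) 0<A₂
      0≤c : 0ℤ ≤ c
      0≤c = 0≤i*j (0≤i*i g₁) (0≤i*j (<⇒≤ 0<A₁) (<⇒≤ 0<D₂))
      key : D₁ * A₁ * (F₀ * F₂) ≤ D₀ * A₂ * (F₁ * F₁)
      key = *-mono-≤-nonNeg (0≤i*j (<⇒≤ 0<D₁) (<⇒≤ 0<A₁)) (0≤i*i F₁) DA-mono F-log-concave

  pascal-preserves-ratio : ∀ x y z g₀ g₁ g₂ →
    g₁ * (y - 1ℤ) ≡ g₀ * (x * z - 1ℤ) → g₂ * (x * y - 1ℤ) ≡ g₁ * (z - 1ℤ) →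
    (g₁ + x * y * g₂) * (x * y - 1ℤ) ≡ (g₀ + y * g₁) * (x * z - 1ℤ)
  pascal-preserves-ratio x y z g₀ g₁ g₂ ratio₁ ratio₂ = begin
    (g₁ + x * y * g₂) * (x * y - 1ℤ)                 ≡⟨ expand g₁ g₂ x y ⟩
    g₁ * (x * y - 1ℤ) + x * y * (g₂ * (x * y - 1ℤ))  ≡⟨ cong (λ t → g₁ * (x * y - 1ℤ) + x * y * t) ratio₂ ⟩
    g₁ * (x * y - 1ℤ) + x * y * (g₁ * (z - 1ℤ))      ≡⟨ regroup g₁ x y z ⟩
    g₁ * (y - 1ℤ) + y * g₁ * (x * z - 1ℤ)            ≡⟨ cong (_+ y * g₁ * (x * z - 1ℤ)) ratio₁ ⟩
    g₀ * (x * z - 1ℤ) + y * g₁ * (x * z - 1ℤ)        ≡⟨ collect g₀ (y * g₁) (x * z) ⟩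
    (g₀ + y * g₁) * (x * z - 1ℤ)                     ∎
    where
    open ≡-Reasoning
    expand : ∀ g₁ g₂ x y → (g₁ + x * y * g₂) * (x * y - 1ℤ) ≡ g₁ * (x * y - 1ℤ) + x * y * (g₂ * (x * y - 1ℤ))
    expand = solve-∀
    regroup : ∀ g x y z → g * (x * y - 1ℤ) + x * y * (g * (z - 1ℤ)) ≡ g * (y - 1ℤ) + y * g * (x * z - 1ℤ)
    regroup = solve-∀
    collect : ∀ a b w → a * (w - 1ℤ) + b * (w - 1ℤ) ≡ (a + b) * (w - 1ℤ)
    collect = solve-∀

  gauss-zero : ∀ q n → gauss q n 0 ≡ 1
  gauss-zero q zero    = refl
  gauss-zero q (suc n) = refl

  gauss-vanishes : ∀ q {n k} → n ℕ.< k → gauss q n k ≡ 0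
  gauss-vanishes q {zero}  {suc k} _ = refl
  gauss-vanishes q {suc n} {suc k} (s≤s n<k)
    rewrite gauss-vanishes q n<k | gauss-vanishes q (ℕ.m<n⇒m<1+n n<k) = ℕ.*-zeroʳ (q ℕ.^ suc k)

  pos-^ : ∀ q k → + (q ℕ.^ k) ≡ (+ q) ^ k
  pos-^ q zero    = refl
  pos-^ q (suc k) = trans (pos-* q (q ℕ.^ k)) (cong (+ q *_) (pos-^ q k))

  gauss-pascal : ∀ q n k → + gauss q (suc n) (suc k) ≡ + gauss q n k + (+ q) ^ suc k * + gauss q n (suc k)
  gauss-pascal q n k =
    trans (pos-+ (gauss q n k) _) (cong (λ t → + gauss q n k + t)
      (trans (pos-* (q ℕ.^ suc k) (gauss q n (suc k))) (cong (_* + gauss q n (suc k)) (pos-^ q (suc k)))))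

  gauss-ratio : ∀ q n k → + gauss q n (suc k) * ((+ q) ^ suc k - 1ℤ) ≡ + gauss q n k * ((+ q) ^ (n ∸ k) - 1ℤ)
  gauss-ratio q zero    zero    = refl
  gauss-ratio q zero    (suc k) = refl
  -- k = 0 is the Pascal step from k = -1, with [n -1]_q = 0.
  gauss-ratio q (suc n) zero    = begin
    + gauss q (suc n) 1 * (x ^ 1 - 1ℤ)           ≡⟨ cong (_* (x ^ 1 - 1ℤ)) (gauss-pascal q n 0) ⟩
    (+ gauss q n 0 + x ^ 1 * g₁) * (x ^ 1 - 1ℤ)  ≡⟨ cong (λ t → (+ t + x ^ 1 * g₁) * (x ^ 1 - 1ℤ)) (gauss-zero q n) ⟩
    (1ℤ + x * 1ℤ * g₁) * (x * 1ℤ - 1ℤ)          ≡⟨ pascal-preserves-ratio x 1ℤ (x ^ n) 0ℤ 1ℤ g₁ refl ih ⟩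
    1ℤ * (x ^ suc n - 1ℤ)                        ∎
    where
    open ≡-Reasoning
    x g₁ : ℤ
    x = + q
    g₁ = + gauss q n 1
    ih : g₁ * (x * 1ℤ - 1ℤ) ≡ 1ℤ * (x ^ n - 1ℤ)
    ih = trans (gauss-ratio q n 0) (cong (λ t → + t * (x ^ n - 1ℤ)) (gauss-zero q n))
  gauss-ratio q (suc n) (suc k) with k ℕ.<? n
  ... | no k≮n
    rewrite gauss-vanishes q {suc n} {suc (suc k)} (s≤s (s≤s (ℕ.≮⇒≥ k≮n)))
          | ℕ.m≤n⇒m∸n≡0 (ℕ.≮⇒≥ k≮n) = sym (*-zeroʳ (+ gauss q (suc n) (suc k)))
  ... | yes k<n = begin
    + gauss q (suc n) (suc (suc k)) * (x * y - 1ℤ)  ≡⟨ cong (_* (x * y - 1ℤ)) (gauss-pascal q n (suc k)) ⟩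
    (g₁ + x * y * g₂) * (x * y - 1ℤ)                ≡⟨ pascal-preserves-ratio x y z g₀ g₁ g₂ ih (gauss-ratio q n (suc k)) ⟩
    (g₀ + y * g₁) * (x * z - 1ℤ)                    ≡⟨ cong₂ (λ s e → s * (x ^ e - 1ℤ)) (gauss-pascal q n k) n∸k≡1+n∸[1+k] ⟨
    + gauss q (suc n) (suc k) * (x ^ (n ∸ k) - 1ℤ)  ∎
    where
    open ≡-Reasoning
    x y z g₀ g₁ g₂ : ℤ
    x = + q
    y = x ^ suc k
    z = x ^ (n ∸ suc k)
    g₀ = + gauss q n k
    g₁ = + gauss q n (suc k)
    g₂ = + gauss q n (suc (suc k))
    n∸k≡1+n∸[1+k] : n ∸ k ≡ suc (n ∸ suc k)
    n∸k≡1+n∸[1+k] = ℕ.+-∸-assoc 1 k<n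
    ih : g₁ * (y - 1ℤ) ≡ g₀ * (x * z - 1ℤ)
    ih = trans (gauss-ratio q n k) (cong (λ e → g₀ * (x ^ e - 1ℤ)) n∸k≡1+n∸[1+k])

  mult-gauss-ratio : ∀ q n k → mult q n k * ((+ q) ^ (suc n ∸ k) - 1ℤ) ≡ + gauss q n k * ((+ q) ^ (suc n ∸ k) - (+ q) ^ k)
  mult-gauss-ratio q n zero    = drop-zero (+ gauss q n 0) ((+ q) ^ suc n)
    where
    drop-zero : ∀ g w → (g - 0ℤ) * (w - 1ℤ) ≡ g * (w - 1ℤ)
    drop-zero = solve-∀
  mult-gauss-ratio q n (suc k) = begin
    (g₁ - g₀) * (w - 1ℤ)                   ≡⟨ distrib g₁ g₀ w ⟩
    g₁ * (w - 1ℤ) - g₀ * (w - 1ℤ)          ≡⟨ cong (g₁ * (w - 1ℤ) -_) (gauss-ratio q n k) ⟨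
    g₁ * (w - 1ℤ) - g₁ * (y - 1ℤ)          ≡⟨ cancel g₁ w y ⟩
    g₁ * (w - y)                           ∎
    where
    open ≡-Reasoning
    g₀ g₁ w y : ℤ
    g₀ = + gauss q n k
    g₁ = + gauss q n (suc k)
    w = (+ q) ^ (n ∸ k)
    y = (+ q) ^ suc k
    distrib : ∀ a b w → (a - b) * (w - 1ℤ) ≡ a * (w - 1ℤ) - b * (w - 1ℤ)
    distrib = solve-∀
    cancel : ∀ g w y → g * (w - 1ℤ) - g * (y - 1ℤ) ≡ g * (w - y)
    cancel = solve-∀

  mult-log-concave : ∀ {q n j} → 2 ℕ.≤ q → suc (suc j) ℕ.≤ n →
                     mult q n j * mult q n (suc (suc j)) ≤ mult q n (suc j) * mult q n (suc j)
  mult-log-concave {q} {n} {j} 2≤q j+2≤n =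
    LogConcavityTransfer.log-concave (λ i → + gauss q n i) (mult q n) D A F (gauss-ratio q n) (mult-gauss-ratio q n) j
      (0<x^k-1 (suc n ∸ j) (ℕ.m<n⇒0<n∸m (ℕ.m<n⇒m<1+n j<n))) (0<x^k-1 (n ∸ j) (ℕ.m<n⇒0<n∸m j<n))
      (0<x^k-1 (n ∸ suc j) (ℕ.m<n⇒0<n∸m j+2≤n)) (0<x^k-1 (suc j) ℕ.z<s) (0<x^k-1 (suc (suc j)) ℕ.z<s)
      DA-mono F-log-concave
    where
    x : ℤ
    x = + q
    D A F : ℕ → ℤ
    D i = x ^ (suc n ∸ i) - 1ℤ
    A i = x ^ i - 1ℤ
    F i = x ^ (suc n ∸ i) - x ^ i

    1<x : 1ℤ < x
    1<x = +<+ 2≤q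
    0<x^k-1 : ∀ k → 0 ℕ.< k → 0ℤ < x ^ k - 1ℤ
    0<x^k-1 = 0<i^n-1 1<x
    j<n : j ℕ.< n
    j<n = ℕ.<-trans (ℕ.n<1+n j) j+2≤n

    DA-mono : D (suc j) * A (suc j) ≤ D j * A (suc (suc j))
    DA-mono = *-mono-≤-nonNeg (<⇒≤ (0<x^k-1 (n ∸ j) (ℕ.m<n⇒0<n∸m j<n))) (<⇒≤ (0<x^k-1 (suc (suc j)) ℕ.z<s))
      (+-monoˡ-≤ -1ℤ (^-monoʳ-≤ (<⇒≤ 1<x) (ℕ.∸-monoˡ-≤ j (ℕ.n≤1+n n))))
      (+-monoˡ-≤ -1ℤ (^-monoʳ-≤ (<⇒≤ 1<x) (ℕ.n≤1+n (suc j))))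

    F-log-concave : (x ^ (suc n ∸ j) - x ^ j) * (x ^ (n ∸ suc j) - x ^ suc (suc j))
                  ≤ (x ^ (n ∸ j) - x ^ suc j) * (x ^ (n ∸ j) - x ^ suc j)
    F-log-concave rewrite ℕ.+-∸-assoc 1 (ℕ.<⇒≤ j<n) | ℕ.+-∸-assoc 1 j<n =
      [x²y-z][y-x²z]≤[xy-xz]² x (x ^ (n ∸ suc j)) (x ^ j)
        (0≤i*j (≤-trans (+≤+ z≤n) (1≤i^n (<⇒≤ 1<x) (n ∸ suc j))) (≤-trans (+≤+ z≤n) (1≤i^n (<⇒≤ 1<x) j)))

open import Data.Nat using (_+_; _*_; _^_; _<_; _≤_)

theorem7 : (q n d : ℕ) → (∃₂ λ p k → Prime p × q ≡ p ^ suc k) →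
           1 ≤ n → 1 ≤ d → 2 * d < n + 1 →
           (i : ℕ) → 1 ≤ i → i + 1 ≤ d →
           mult q n i ℤ.* mult q n i ℤ.≥ mult q n (i ∸ 1) ℤ.* mult q n (i + 1)
theorem7 q n d (p , k , p-prime , q≡p^[1+k]) _ _ 2d<n+1 (suc j) (s≤s _) i+1≤d
  rewrite ℕ.+-comm j 1 = mult-log-concave 2≤q j+2≤n
  where
  2≤q : 2 ≤ q
  2≤q = subst (2 ≤_) (sym q≡p^[1+k])
    (ℕ.≤-trans (ℕ.nonTrivial⇒n>1 p {{prime⇒nonTrivial p-prime}})
               (ℕ.m≤m*n p (p ^ k) {{ℕ.m^n≢0 p k {{prime⇒nonZero p-prime}}}}))
  j+2≤n : suc (suc j) ≤ n
  j+2≤n = ℕ.≤-trans i+1≤d (ℕ.≤-trans (ℕ.m≤n*m d 2) (ℕ.m<1+n⇒m≤n (subst (2 * d <_) (ℕ.+-comm n 1) 2d<n+1)))
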